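{- For every integer $d \ge 1$, $\mathrm{TTT}(4,2,d) + 1 \le \mathrm{Gr}(d+1)$.
   Context: For a finite alphabet $A$ with $|A|\ge 2$ and a group $G$ acting on $A$, a $k$-parameter subset of $A^n$ is the image of an injective map $f : A^k \to A^n$ such that for each coordinate $1 \le i \le n$, either $f_i(x_1,\dots,x_k) = a$ for some constant $a \in A$, or $f_i(x_1,\dots,x_k) = \sigma(x_j)$ for some $1\le j\le k$ and some $\sigma \in G$ (injectivity means every variable $x_j$ appears in some coordinate). Tic-tac-toe numbers: take $A = [t] = \{1,\dots,t\}$ and $G = \{e,\pi\}$ with $e(x)=x$, $\pi(x) = t+1-x$. A $d$-parameter subset of $[t]^n$ for this $G$ is called a $d$-dimensional tic-tac-toe space. $\mathrm{TTT}(t,k,d)$ is the least $n$ such that every $k$-coloring of the points of $[t]^n$ contains a monochromatic $d$-dimensional tic-tac-toe space. Graham numbers: take $A = \{\pm 1\}$ and $G = \{x\mapsto x, x \mapsto -x\}$. A $d$-parameter subset of $\{\pm1\}^n$ for this $G$ is called a $d$-dimensional subcube. An edge-coloring of $\{\pm1\}^n$ is a $2$-coloring of all edges of the complete graph on the $2^n$ points of $\{\pm1\}^n$. $\mathrm{Gr}(d)$ is the least $n$ such that every edge-coloring of $\{\pm1\}^n$ contains a $d$-dimensional subcube all of whose pairs of points (edges of the complete graph on its $2^d$ points) have the same color. -}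

module Defs where

open import Data.Nat using (ℕ; suc; _≤_; _+_)
open import Data.Fin using (Fin; opposite)
open import Data.Bool using (Bool; true; false; not)
open import Data.Vec using (Vec; lookup; tabulate)
open import Data.Sum using (_⊎_; inj₁; inj₂)
open import Data.Product using (Σ; ∃; ∃-syntax; _×_; _,_)
open import Relation.Binary.PropositionalEquality using (_≡_; _≢_)

-- A group G = {e, g} of order ≤ 2 acting on A is encoded by
-- act : Bool → A → A, where act false = identity and act true = the
-- non-trivial element (x ↦ t+1-x, resp. x ↦ -x).

-- A k-parameter subset of A^n: each coordinate i is either a constant
-- a ∈ A (inj₁ a) or σ(x_j) (inj₂ (j , b), σ = act b).  Injectivity of the
-- induced map is expressed as: every variable x_j occurs in some coordinate.
record ParamSubset (A : Set) (k n : ℕ) : Set where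
  field
    coord  : Fin n → A ⊎ (Fin k × Bool)
    covers : (j : Fin k) → ∃[ i ] ∃[ b ] (coord i ≡ inj₂ (j , b))

open ParamSubset public

evalPS : {A : Set} {k n : ℕ} → (Bool → A → A) → ParamSubset A k n → Vec A k → Vec A n
evalPS act P x = tabulate λ i → go (coord P i)
  where
  go : _ ⊎ _ → _
  go (inj₁ a)       = a
  go (inj₂ (j , b)) = act b (lookup x j)

tttAct : {t : ℕ} → Bool → Fin t → Fin t
tttAct false x = x
tttAct true  x = opposite x

TTTProp : (t k d n : ℕ) → Set
TTTProp t k d n =
  (c : Vec (Fin t) n → Fin k) →
  ∃[ P ] ∃[ col ] ((x : Vec (Fin t) d) → c (evalPS tttAct P x) ≡ col)

-- Graham: A = {±1} (as Bool), nontrivial group element = negation.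
grAct : Bool → Bool → Bool
grAct false x = x
grAct true  x = not x

-- An edge-colouring of {±1}^n: a 2-colouring of the pairs of points,
-- given as a symmetric function (diagonal values are irrelevant).
IsEdgeColouring : {n : ℕ} → (Vec Bool n → Vec Bool n → Bool) → Set
IsEdgeColouring c = ∀ x y → c x y ≡ c y x

GrProp : (d n : ℕ) → Set
GrProp d n =
  (c : Vec Bool n → Vec Bool n → Bool) → IsEdgeColouring c →
  ∃[ P ] ∃[ col ] ((x y : Vec Bool d) → x ≢ y →
     c (evalPS grAct P x) (evalPS grAct P y) ≡ col)

-- Encode a pair of bits as a letter of [4] = {00, 01, 10, 11}; negating both bits is then
-- the reflection of [4].  Given a 2-colouring χ of [4]^m, colour an edge {x, y} of
-- {±1}^(m+1) by χ of its derived word: the coordinates before the first disagreement i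
-- become the letters aa, and the coordinates after i become the pairs (x_j, y_j), with x
-- the endpoint that is 0 at i.  In a monochromatic (d+1)-dimensional subcube let x_k be
-- the variable of the first non-constant coordinate.  Fixing x_k at the two values that
-- make the endpoints disagree there, and letting every other variable run over pairs of
-- bits, the derived words trace out a d-dimensional tic-tac-toe space of [4]^m, which is
-- therefore monochromatic.
module Submission where

open import Defs
open import Data.Nat using (ℕ; zero; suc; _≤_; _+_)
open import Data.Nat.Properties using (≤-reflexive; +-comm)
open import Data.Fin using (Fin; zero; suc; punchIn; punchOut; _≟_)
open import Data.Fin.Patterns using (0F; 1F; 2F; 3F)
open import Data.Fin.Properties using (punchInᵢ≢i; punchOut-cong′; punchOut-punchIn; punchIn-punchOut; 2↔Bool)
open import Data.Bool using (Bool; true; false; not)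
open import Data.Vec using (Vec; []; _∷_; lookup; tabulate; zipWith; map; insertAt)
open import Data.Vec.Properties using (lookup∘tabulate; tabulate∘lookup; tabulate-cong; insertAt-lookup; insertAt-punchIn; lookup-map)
import Data.Vec.Functional as Vector
open import Data.Sum using (_⊎_; inj₁; inj₂)
open import Data.Sum.Properties using (inj₂-injective)
open import Data.Product using (∃-syntax; _×_; _,_; proj₁)
open import Data.Empty using (⊥-elim)
open import Function using (_∘_; _∋_)
open import Function.Bundles using (Inverse)
open import Relation.Nullary using (yes; no; ¬_)
open import Relation.Binary.PropositionalEquality

open Inverse 2↔Bool using (to; from; strictlyInverseʳ)

Coord : Set → ℕ → Set
Coord A k = A ⊎ (Fin k × Bool)

Covers : {A : Set} {k n : ℕ} → (Fin n → Coord A k) → Set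
Covers {k = k} co = (j : Fin k) → ∃[ i ] ∃[ b ] (co i ≡ inj₂ (j , b))

evalCoord : {A : Set} {k : ℕ} → (Bool → A → A) → Vec A k → Coord A k → A
evalCoord act x (inj₁ a)       = a
evalCoord act x (inj₂ (j , b)) = act b (lookup x j)

eval : {A : Set} {k n : ℕ} → (Bool → A → A) → (Fin n → Coord A k) → Vec A k → Vec A n
eval act co x = tabulate (evalCoord act x ∘ co)

-- The coordinate evaluator of evalPS is local to it, so it is reached by unification.
lookup-evalPS : {A : Set} {k n : ℕ} (act : Bool → A → A) (P : ParamSubset A k n) (x : Vec A k) (i : Fin n) →
  lookup (evalPS act P x) i ≡ evalCoord act x (coord P i)
lookup-evalPS act P x i with (lookup (evalPS act P x) i ≡ _) ∋ lookup∘tabulate _ i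
... | lookup≡ with coord P i
...   | inj₁ _ = lookup≡
...   | inj₂ _ = lookup≡

evalPS≡eval : {A : Set} {k n : ℕ} (act : Bool → A → A) (P : ParamSubset A k n) (x : Vec A k) →
  evalPS act P x ≡ eval act (coord P) x
evalPS≡eval act P x = trans (sym (tabulate∘lookup _)) (tabulate-cong (lookup-evalPS act P x))

tail-covers : {A : Set} {k m : ℕ} {co : Fin (suc m) → Coord A k} {a : A} →
  co zero ≡ inj₁ a → Covers co → Covers (co ∘ suc)
tail-covers co₀≡ cov j with cov j
... | zero  , b , co₀≡′ with () ← trans (sym co₀≡) co₀≡′
... | suc i , b , coᵢ≡ = i , b , coᵢ≡

¬ParamSubset-into-A⁰ : {A : Set} {k : ℕ} → ¬ ParamSubset A (suc k) 0
¬ParamSubset-into-A⁰ P with covers P zero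
... | () , _

zipWith-tabulate : {A B C : Set} {n : ℕ} (f : A → B → C) (g : Fin n → A) (h : Fin n → B) →
  zipWith f (tabulate g) (tabulate h) ≡ tabulate (λ i → f (g i) (h i))
zipWith-tabulate {n = zero}  f g h = refl
zipWith-tabulate {n = suc n} f g h = cong (f (g zero) (h zero) ∷_) (zipWith-tabulate f (g ∘ suc) (h ∘ suc))

grAct-involutive : (σ b : Bool) → grAct σ (grAct σ b) ≡ b
grAct-involutive false b     = refl
grAct-involutive true  false = refl
grAct-involutive true  true  = refl

grAct-false≢true : (σ : Bool) → grAct σ false ≢ grAct σ true
grAct-false≢true false ()
grAct-false≢true true  ()

encode : Bool → Bool → Fin 4
encode false false = 0F
encode false true  = 1F
encode true  false = 2F
encode true  true  = 3F

bit₁ bit₂ : Fin 4 → Bool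
bit₁ 0F = false
bit₁ 1F = false
bit₁ 2F = true
bit₁ 3F = true
bit₂ 0F = false
bit₂ 1F = true
bit₂ 2F = false
bit₂ 3F = true

encode-grAct : (σ : Bool) (w : Fin 4) → encode (grAct σ (bit₁ w)) (grAct σ (bit₂ w)) ≡ tttAct σ w
encode-grAct false 0F = refl
encode-grAct false 1F = refl
encode-grAct false 2F = refl
encode-grAct false 3F = refl
encode-grAct true  0F = refl
encode-grAct true  1F = refl
encode-grAct true  2F = refl
encode-grAct true  3F = refl

derivedWord : {m : ℕ} → Vec Bool (suc m) → Vec Bool (suc m) → Vec (Fin 4) m
derivedWord {zero}  _           _          = []
derivedWord {suc m} (false ∷ x) (false ∷ y) = encode false false ∷ derivedWord x y
derivedWord {suc m} (true ∷ x)  (true ∷ y)  = encode true true ∷ derivedWord x y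
derivedWord {suc m} (false ∷ x) (true ∷ y)  = zipWith encode x y
derivedWord {suc m} (true ∷ x)  (false ∷ y) = zipWith encode y x

derivedWord-comm : {m : ℕ} (x y : Vec Bool (suc m)) → derivedWord x y ≡ derivedWord y x
derivedWord-comm {zero}  _           _           = refl
derivedWord-comm {suc m} (false ∷ x) (false ∷ y) = cong (encode false false ∷_) (derivedWord-comm x y)
derivedWord-comm {suc m} (true ∷ x)  (true ∷ y)  = cong (encode true true ∷_) (derivedWord-comm x y)
derivedWord-comm {suc m} (false ∷ x) (true ∷ y)  = refl
derivedWord-comm {suc m} (true ∷ x)  (false ∷ y) = refl

derivedWord-agree : {m : ℕ} (a : Bool) (x y : Vec Bool (suc m)) →
  derivedWord (a ∷ x) (a ∷ y) ≡ encode a a ∷ derivedWord x y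
derivedWord-agree false x y = refl
derivedWord-agree true  x y = refl

derivedWord-disagree : {m : ℕ} (x y : Vec Bool m) → derivedWord (false ∷ x) (true ∷ y) ≡ zipWith encode x y
derivedWord-disagree []      []      = refl
derivedWord-disagree (_ ∷ _) (_ ∷ _) = refl

derivedColouring : {m : ℕ} → (Vec (Fin 4) m → Fin 2) → Vec Bool (suc m) → Vec Bool (suc m) → Bool
derivedColouring χ x y = to (χ (derivedWord x y))

derivedColouring-isEdgeColouring : {m : ℕ} (χ : Vec (Fin 4) m → Fin 2) → IsEdgeColouring (derivedColouring χ)
derivedColouring-isEdgeColouring χ x y = cong (to ∘ χ) (derivedWord-comm x y)

module _ {d : ℕ} (k : Fin (suc d)) (σ : Bool) where

  pointˡ pointʳ : Vec (Fin 4) d → Vec Bool (suc d)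
  pointˡ z = insertAt (map bit₁ z) k (grAct σ false)
  pointʳ z = insertAt (map bit₂ z) k (grAct σ true)

  pointˡ≢pointʳ : (z : Vec (Fin 4) d) → pointˡ z ≢ pointʳ z
  pointˡ≢pointʳ z eq = grAct-false≢true σ (begin
    grAct σ false       ≡⟨ insertAt-lookup (map bit₁ z) k _ ⟨
    lookup (pointˡ z) k ≡⟨ cong (λ v → lookup v k) eq ⟩
    lookup (pointʳ z) k ≡⟨ insertAt-lookup (map bit₂ z) k _ ⟩
    grAct σ true        ∎)
    where open ≡-Reasoning

  -- Graham coordinates after the first variable coordinate, which is σ(x_k), read as
  -- coordinates of the derived words of the pairs (pointˡ z, pointʳ z).
  collapse : Coord Bool (suc d) → Coord (Fin 4) d
  collapse (inj₁ a) = inj₁ (encode a a)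
  collapse (inj₂ (j , τ)) with k ≟ j
  ... | yes _   = inj₁ (encode (grAct τ (grAct σ false)) (grAct τ (grAct σ true)))
  ... | no k≢j = inj₂ (punchOut k≢j , τ)

  lookup-insertAt-punchOut : (f : Fin 4 → Bool) (b : Bool) (z : Vec (Fin 4) d) {j : Fin (suc d)} (k≢j : k ≢ j) →
    lookup (insertAt (map f z) k b) j ≡ f (lookup z (punchOut k≢j))
  lookup-insertAt-punchOut f b z {j} k≢j = begin
    lookup (insertAt (map f z) k b) j
      ≡⟨ cong (lookup (insertAt (map f z) k b)) (punchIn-punchOut k≢j) ⟨
    lookup (insertAt (map f z) k b) (punchIn k (punchOut k≢j))
      ≡⟨ insertAt-punchIn (map f z) k b (punchOut k≢j) ⟩
    lookup (map f z) (punchOut k≢j)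
      ≡⟨ lookup-map (punchOut k≢j) f z ⟩
    f (lookup z (punchOut k≢j)) ∎
    where open ≡-Reasoning

  encode-collapse : (z : Vec (Fin 4) d) (c : Coord Bool (suc d)) →
    encode (evalCoord grAct (pointˡ z) c) (evalCoord grAct (pointʳ z) c) ≡ evalCoord tttAct z (collapse c)
  encode-collapse z (inj₁ a) = refl
  encode-collapse z (inj₂ (j , τ)) with k ≟ j
  ... | yes refl rewrite insertAt-lookup (map bit₁ z) k (grAct σ false)
                       | insertAt-lookup (map bit₂ z) k (grAct σ true) = refl
  ... | no k≢j = begin
    encode (grAct τ (lookup (pointˡ z) j)) (grAct τ (lookup (pointʳ z) j))
      ≡⟨ cong₂ (λ u v → encode (grAct τ u) (grAct τ v))
               (lookup-insertAt-punchOut bit₁ _ z k≢j) (lookup-insertAt-punchOut bit₂ _ z k≢j) ⟩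
    encode (grAct τ (bit₁ (lookup z (punchOut k≢j)))) (grAct τ (bit₂ (lookup z (punchOut k≢j))))
      ≡⟨ encode-grAct τ (lookup z (punchOut k≢j)) ⟩
    tttAct τ (lookup z (punchOut k≢j)) ∎
    where open ≡-Reasoning

  module _ {m : ℕ} {co : Fin (suc m) → Coord Bool (suc d)} (co₀≡ : co zero ≡ inj₂ (k , σ)) where

    collapse-covers : Covers co → Covers (collapse ∘ co ∘ suc)
    collapse-covers cov j with cov (punchIn k j)
    ... | zero , b , co₀≡′ = ⊥-elim (punchInᵢ≢i k j (sym (cong proj₁ (inj₂-injective (trans (sym co₀≡) co₀≡′)))))
    ... | suc i , b , coᵢ≡ = i , b , collapse-punchIn
      where
      collapse-punchIn : collapse (co (suc i)) ≡ inj₂ (j , b)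
      collapse-punchIn rewrite coᵢ≡ with k ≟ punchIn k j
      ... | yes k≡ = ⊥-elim (punchInᵢ≢i k j (sym k≡))
      ... | no k≢ = cong (λ j′ → inj₂ (j′ , b)) (trans (punchOut-cong′ k refl) (punchOut-punchIn k))

    derivedWord-collapse : (z : Vec (Fin 4) d) →
      derivedWord (eval grAct co (pointˡ z)) (eval grAct co (pointʳ z)) ≡ eval tttAct (collapse ∘ co ∘ suc) z
    derivedWord-collapse z = begin
      derivedWord (eval grAct co (pointˡ z)) (eval grAct co (pointʳ z))
        ≡⟨ cong₂ (λ a b → derivedWord (a ∷ eval grAct (co ∘ suc) (pointˡ z)) (b ∷ eval grAct (co ∘ suc) (pointʳ z)))
                 (evalCoord-head (map bit₁ z) false) (evalCoord-head (map bit₂ z) true) ⟩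
      derivedWord (false ∷ eval grAct (co ∘ suc) (pointˡ z)) (true ∷ eval grAct (co ∘ suc) (pointʳ z))
        ≡⟨ derivedWord-disagree _ _ ⟩
      zipWith encode (eval grAct (co ∘ suc) (pointˡ z)) (eval grAct (co ∘ suc) (pointʳ z))
        ≡⟨ zipWith-tabulate encode _ _ ⟩
      tabulate (λ i → encode (evalCoord grAct (pointˡ z) (co (suc i))) (evalCoord grAct (pointʳ z) (co (suc i))))
        ≡⟨ tabulate-cong (encode-collapse z ∘ co ∘ suc) ⟩
      eval tttAct (collapse ∘ co ∘ suc) z ∎
      where
      open ≡-Reasoning
      evalCoord-head : (v : Vec Bool d) (b : Bool) → evalCoord grAct (insertAt v k (grAct σ b)) (co zero) ≡ b
      evalCoord-head v b = begin
        evalCoord grAct (insertAt v k (grAct σ b)) (co zero) ≡⟨ cong (evalCoord grAct _) co₀≡ ⟩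
        grAct σ (lookup (insertAt v k (grAct σ b)) k)       ≡⟨ cong (grAct σ) (insertAt-lookup v k _) ⟩
        grAct σ (grAct σ b)                                 ≡⟨ grAct-involutive σ b ⟩
        b                                                   ∎

DerivedTTTSpace : {d m : ℕ} → (Fin (suc m) → Coord Bool (suc d)) → Set
DerivedTTTSpace {d} {m} co =
  ∃[ Q ] Covers Q × ((z : Vec (Fin 4) d) → ∃[ x ] ∃[ y ] (x ≢ y ×
    derivedWord (eval grAct co x) (eval grAct co y) ≡ eval tttAct Q z))

derivedTTTSpace : {d m : ℕ} (co : Fin (suc m) → Coord Bool (suc d)) → Covers co → DerivedTTTSpace co
constantHead-derivedTTTSpace : {d m : ℕ} {co : Fin (suc m) → Coord Bool (suc d)} {a : Bool} →
  co zero ≡ inj₁ a → Covers co → DerivedTTTSpace co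

derivedTTTSpace {d} co cov = byFirstCoordinate (co zero) refl
  where
  byFirstCoordinate : (c : Coord Bool (suc d)) → co zero ≡ c → DerivedTTTSpace co
  byFirstCoordinate (inj₁ a)       co₀≡ = constantHead-derivedTTTSpace co₀≡ cov
  byFirstCoordinate (inj₂ (k , σ)) co₀≡ =
    collapse k σ ∘ co ∘ suc , collapse-covers k σ {co = co} co₀≡ cov ,
    λ z → pointˡ k σ z , pointʳ k σ z , pointˡ≢pointʳ k σ z , derivedWord-collapse k σ {co = co} co₀≡ z

constantHead-derivedTTTSpace {m = zero} co₀≡ cov with tail-covers co₀≡ cov zero
... | () , _
constantHead-derivedTTTSpace {m = suc m} {co} {a} co₀≡ cov with derivedTTTSpace (co ∘ suc) (tail-covers co₀≡ cov)
... | Q , covQ , onTail = inj₁ (encode a a) Vector.∷ Q , (λ j → let i , b , eq = covQ j in suc i , b , eq) , onWord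
  where
  onWord : (z : Vec (Fin 4) _) → ∃[ x ] ∃[ y ] (x ≢ y ×
    derivedWord (eval grAct co x) (eval grAct co y) ≡ eval tttAct (inj₁ (encode a a) Vector.∷ Q) z)
  onWord z with onTail z
  ... | x , y , x≢y , onTail≡ = x , y , x≢y , (begin
    derivedWord (eval grAct co x) (eval grAct co y)
      ≡⟨ cong₂ (λ u v → derivedWord (u ∷ eval grAct (co ∘ suc) x) (v ∷ eval grAct (co ∘ suc) y))
               (cong (evalCoord grAct x) co₀≡) (cong (evalCoord grAct y) co₀≡) ⟩
    derivedWord (a ∷ eval grAct (co ∘ suc) x) (a ∷ eval grAct (co ∘ suc) y)
      ≡⟨ derivedWord-agree a _ _ ⟩
    encode a a ∷ derivedWord (eval grAct (co ∘ suc) x) (eval grAct (co ∘ suc) y)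
      ≡⟨ cong (encode a a ∷_) onTail≡ ⟩
    encode a a ∷ eval tttAct Q z ∎)
    where open ≡-Reasoning

subcube-derivedTTTSpace : {d m : ℕ} (P : ParamSubset Bool (suc d) (suc m)) →
  ∃[ Q ] ((z : Vec (Fin 4) d) → ∃[ x ] ∃[ y ] (x ≢ y ×
    derivedWord (evalPS grAct P x) (evalPS grAct P y) ≡ evalPS tttAct Q z))
subcube-derivedTTTSpace {d} {m} P with derivedTTTSpace (coord P) (covers P)
... | Q , covQ , onWord = Q′ , λ z → let x , y , x≢y , eq = onWord z in
  x , y , x≢y , trans (cong₂ derivedWord (evalPS≡eval grAct P x) (evalPS≡eval grAct P y))
                      (trans eq (sym (evalPS≡eval tttAct Q′ z)))
  where
  Q′ : ParamSubset (Fin 4) d m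
  Q′ = record { coord = Q ; covers = covQ }

theorem1p2 : (d : ℕ) → 1 ≤ d → (n : ℕ) → GrProp (suc d) n →
    ∃[ m ] (m + 1 ≤ n × TTTProp 4 2 d m)
theorem1p2 d _ zero    gr = ⊥-elim (¬ParamSubset-into-A⁰ (proj₁ (gr (λ _ _ → true) (λ _ _ → refl))))
theorem1p2 d _ (suc m) gr = m , ≤-reflexive (+-comm m 1) , monochromatic
  where
  monochromatic : TTTProp 4 2 d m
  monochromatic χ with gr (derivedColouring χ) (derivedColouring-isEdgeColouring χ)
  ... | P , col , P-mono with subcube-derivedTTTSpace P
  ... | Q , onWord = Q , from col , λ z → let x , y , x≢y , eq = onWord z in begin
    χ (evalPS tttAct Q z)                                           ≡⟨ cong χ eq ⟨
    χ (derivedWord (evalPS grAct P x) (evalPS grAct P y))           ≡⟨ strictlyInverseʳ _ ⟨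
    from (derivedColouring χ (evalPS grAct P x) (evalPS grAct P y)) ≡⟨ cong from (P-mono x y x≢y) ⟩
    from col                                                        ∎
    where open ≡-Reasoning
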